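{- Let $1 \le m \le n$, let $d$ be a positive integer, let $w_1,\dots,w_m \in GF(2)^n$ be linearly independent, and let $G$ be the associated lexigraph. Then for all $j, k \in \{0,\dots,2^m-1\}$, $$F(A_j \oplus A_k) \subseteq \big(A_j \oplus F(A_k)\big) \cup \big(F(A_j) \oplus A_k\big) \subseteq F(A_j \oplus A_k) \cup F^{ -1}(A_j \oplus A_k).$$
   Context: For $k \in \{0,\dots,2^m-1\}$ with binary digits $k^h$ ($k = \sum_h k^h 2^h$), set $A_k = \sum_{h=0}^{m-1} k^h w_{h+1} \in GF(2)^n$; these are the $2^m$ elements of the span $V^m$ of $w_1,\dots,w_m$. For a vector $A$, $w(A)$ is its Hamming weight (number of nonzero coordinates) and $\oplus$ is addition in $GF(2)^n$. The lexigraph is the digraph $G=(V,E)$ with vertex set $V = V^m = \{A_0,\dots,A_{2^m-1}\}$ and $(A_k, A_j) \in E$ if and only if $j < k$ and $w(A_j \oplus A_k) < d$. For a vertex $u$, $F(u) = \{v : (u,v) \in E\}$ (followers) and $F^{ -1}(u) = \{v : (v,u)\in E\}$ (ancestors). For a vector $A$ and set $S$ of vectors, $A \oplus S = S \oplus A = \{A \oplus s : s \in S\}$. -}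

module Defs where

open import Data.Bool using (Bool; true; false; _xor_; if_then_else_)
open import Data.Nat using (ℕ; zero; suc; _+_; _<_; _^_; _/_; _%_; _≡ᵇ_)
open import Data.Vec using (Vec; []; _∷_; zipWith; replicate)
open import Data.Product using (Σ; ∃; _×_; _,_)
open import Relation.Binary.PropositionalEquality using (_≡_)
open import Relation.Unary using (Pred)
open import Level using (0ℓ)

GF2 : ℕ → Set
GF2 n = Vec Bool n

𝟎 : ∀ {n} → GF2 n
𝟎 = replicate _ false

infixl 6 _⊕_
_⊕_ : ∀ {n} → GF2 n → GF2 n → GF2 n
_⊕_ = zipWith _xor_

_·_ : ∀ {n} → Bool → GF2 n → GF2 n
true  · v = v
false · v = 𝟎

weight : ∀ {n} → GF2 n → ℕ
weight [] = 0
weight (true ∷ v) = suc (weight v)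
weight (false ∷ v) = weight v

linComb : ∀ {m n} → Vec Bool m → Vec (GF2 n) m → GF2 n
linComb [] [] = 𝟎
linComb (c ∷ cs) (w ∷ ws) = c · w ⊕ linComb cs ws

LinIndep : ∀ {m n} → Vec (GF2 n) m → Set
LinIndep {m} ws = (c : Vec Bool m) → linComb c ws ≡ 𝟎 → c ≡ replicate _ false

-- A_k = Σ_{h=0}^{m-1} k^h w_{h+1}, where k^h is the h-th binary digit of k.
-- Recursion: the lowest digit (k % 2) multiplies the first vector w_1,
-- and the remaining digits are those of k / 2.
A : ∀ {m n} → Vec (GF2 n) m → ℕ → GF2 n
A [] k = 𝟎
A (w ∷ ws) k = ((k % 2) ≡ᵇ 1) · w ⊕ A ws (k / 2)

Edge : ∀ {m n} → Vec (GF2 n) m → ℕ → GF2 n → GF2 n → Set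
Edge {m} ws d u v =
  Σ ℕ λ k → Σ ℕ λ j →
    k < 2 ^ m × j < 2 ^ m × u ≡ A ws k × v ≡ A ws j ×
    j < k × weight (A ws j ⊕ A ws k) < d

F : ∀ {m n} → Vec (GF2 n) m → ℕ → GF2 n → Pred (GF2 n) 0ℓ
F ws d u v = Edge ws d u v

F⁻¹ : ∀ {m n} → Vec (GF2 n) m → ℕ → GF2 n → Pred (GF2 n) 0ℓ
F⁻¹ ws d u v = Edge ws d v u

_⊕ˡ_ : ∀ {n} → GF2 n → Pred (GF2 n) 0ℓ → Pred (GF2 n) 0ℓ
(a ⊕ˡ S) v = Σ (GF2 _) λ s → S s × v ≡ a ⊕ s

_⊕ʳ_ : ∀ {n} → Pred (GF2 n) 0ℓ → GF2 n → Pred (GF2 n) 0ℓ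
(S ⊕ʳ a) v = Σ (GF2 _) λ s → S s × v ≡ s ⊕ a

{-# OPTIONS --safe #-}
module Submission where

-- The edge condition w(A_j ⊕ A_k) < d depends
-- only on the bitwise xor of the digit vectors, so translating by an element of the span maps
-- an edge to an edge, possibly reversed; this gives the second inclusion. For the first, let
-- (A_j ⊕ A_k, A_b) be an edge, so b < j ⊕ k. At the highest digit where b and j ⊕ k differ,
-- j and k differ; if k has the 1 there, then j ⊕ b agrees with k above it and has a 0 there,
-- so j ⊕ b < k and A_b = A_j ⊕ A_{j ⊕ b} with A_{j ⊕ b} ∈ F(A_k). Linear independence is what
-- identifies the source A_j ⊕ A_k of the edge with the index j ⊕ k.

open import Defs
open import Data.Nat using (ℕ; _≤_; _<_; _^_)
open import Data.Vec using (Vec)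
open import Data.Product using (_×_)
open import Relation.Unary using (_⊆_; _∪_)

open import Algebra.Bundles using (CommutativeSemigroup)
import Algebra.Properties.CommutativeSemigroup as CommutativeSemigroupProperties
open import Data.Bool using (Bool; true; false; _xor_)
open import Data.Bool.Properties using (xor-assoc; xor-comm; xor-identityˡ; xor-identityʳ; xor-same)
open import Data.Nat using (zero; suc; _+_; _*_; _%_; _/_; _≡ᵇ_; z≤n; s≤s)
open import Data.Nat.Divisibility using (n∣m*n)
open import Data.Nat.DivMod
open import Data.Nat.Properties
open import Data.Product using (∃₂; _,_)
open import Data.Sum as Sum using (_⊎_; inj₁; inj₂)
open import Data.Vec using ([]; _∷_)
open import Data.Vec.Properties using (zipWith-assoc; zipWith-comm; zipWith-identityˡ; zipWith-identityʳ)
open import Level using (0ℓ)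
open import Relation.Binary using (tri<; tri≈; tri>)
open import Relation.Binary.PropositionalEquality
open import Relation.Binary.PropositionalEquality.Algebra using (isMagma)
open import Relation.Nullary using (contradiction)

⊕-assoc : ∀ {n} (x y z : GF2 n) → (x ⊕ y) ⊕ z ≡ x ⊕ (y ⊕ z)
⊕-assoc = zipWith-assoc xor-assoc

⊕-comm : ∀ {n} (x y : GF2 n) → x ⊕ y ≡ y ⊕ x
⊕-comm = zipWith-comm xor-comm

⊕-identityˡ : ∀ {n} (x : GF2 n) → 𝟎 ⊕ x ≡ x
⊕-identityˡ = zipWith-identityˡ xor-identityˡ

⊕-identityʳ : ∀ {n} (x : GF2 n) → x ⊕ 𝟎 ≡ x
⊕-identityʳ = zipWith-identityʳ xor-identityʳ

⊕-self : ∀ {n} (x : GF2 n) → x ⊕ x ≡ 𝟎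
⊕-self []      = refl
⊕-self (b ∷ x) = cong₂ _∷_ (xor-same b) (⊕-self x)

⊕-commutativeSemigroup : ℕ → CommutativeSemigroup 0ℓ 0ℓ
⊕-commutativeSemigroup n = record
  { Carrier                = GF2 n
  ; _≈_                    = _≡_
  ; _∙_                    = _⊕_
  ; isCommutativeSemigroup = record
    { isSemigroup = record { isMagma = isMagma _⊕_ ; assoc = ⊕-assoc }
    ; comm        = ⊕-comm
    }
  }

module ⊕ {n : ℕ} = CommutativeSemigroupProperties (⊕-commutativeSemigroup n)

x⊕[x⊕y]≡y : ∀ {n} (x y : GF2 n) → x ⊕ (x ⊕ y) ≡ y
x⊕[x⊕y]≡y x y = begin
  x ⊕ (x ⊕ y) ≡⟨ ⊕-assoc x x y ⟨
  (x ⊕ x) ⊕ y ≡⟨ cong (_⊕ y) (⊕-self x) ⟩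
  𝟎 ⊕ y       ≡⟨ ⊕-identityˡ y ⟩
  y           ∎
  where open ≡-Reasoning

x⊕[y⊕x]≡y : ∀ {n} (x y : GF2 n) → x ⊕ (y ⊕ x) ≡ y
x⊕[y⊕x]≡y x y = trans (cong (x ⊕_) (⊕-comm y x)) (x⊕[x⊕y]≡y x y)

[x⊕y]⊕x≡y : ∀ {n} (x y : GF2 n) → (x ⊕ y) ⊕ x ≡ y
[x⊕y]⊕x≡y x y = trans (⊕-comm (x ⊕ y) x) (x⊕[x⊕y]≡y x y)

[c⊕x]⊕[c⊕y]≡x⊕y : ∀ {n} (c x y : GF2 n) → (c ⊕ x) ⊕ (c ⊕ y) ≡ x ⊕ y
[c⊕x]⊕[c⊕y]≡x⊕y c x y = begin
  (c ⊕ x) ⊕ (c ⊕ y) ≡⟨ ⊕.interchange c x c y ⟩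
  (c ⊕ c) ⊕ (x ⊕ y) ≡⟨ cong (_⊕ (x ⊕ y)) (⊕-self c) ⟩
  𝟎 ⊕ (x ⊕ y)       ≡⟨ ⊕-identityˡ (x ⊕ y) ⟩
  x ⊕ y             ∎
  where open ≡-Reasoning

⊕-cancelˡ-≡ : ∀ {n} (c : GF2 n) {x y} → c ⊕ x ≡ c ⊕ y → x ≡ y
⊕-cancelˡ-≡ c {x} {y} eq = begin
  x           ≡⟨ x⊕[x⊕y]≡y c x ⟨
  c ⊕ (c ⊕ x) ≡⟨ cong (c ⊕_) eq ⟩
  c ⊕ (c ⊕ y) ≡⟨ x⊕[x⊕y]≡y c y ⟩
  y           ∎
  where open ≡-Reasoning

x⊕y≡𝟎⇒x≡y : ∀ {n} {x y : GF2 n} → x ⊕ y ≡ 𝟎 → x ≡ y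
x⊕y≡𝟎⇒x≡y {x = x} x⊕y≡𝟎 = ⊕-cancelˡ-≡ x (trans (⊕-self x) (sym x⊕y≡𝟎))

·-distribʳ-xor : ∀ {n} (a b : Bool) (w : GF2 n) → (a xor b) · w ≡ a · w ⊕ b · w
·-distribʳ-xor true  true  w = sym (⊕-self w)
·-distribʳ-xor true  false w = sym (⊕-identityʳ w)
·-distribʳ-xor false b     w = sym (⊕-identityˡ (b · w))

linComb-⊕ : ∀ {m n} (c c′ : Vec Bool m) (ws : Vec (GF2 n) m) →
            linComb (c ⊕ c′) ws ≡ linComb c ws ⊕ linComb c′ ws
linComb-⊕ []      []        []       = sym (⊕-identityˡ 𝟎)
linComb-⊕ (a ∷ c) (a′ ∷ c′) (w ∷ ws) = begin
  (a xor a′) · w ⊕ linComb (c ⊕ c′) ws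
    ≡⟨ cong₂ _⊕_ (·-distribʳ-xor a a′ w) (linComb-⊕ c c′ ws) ⟩
  (a · w ⊕ a′ · w) ⊕ (linComb c ws ⊕ linComb c′ ws)
    ≡⟨ ⊕.interchange (a · w) (a′ · w) (linComb c ws) (linComb c′ ws) ⟩
  (a · w ⊕ linComb c ws) ⊕ (a′ · w ⊕ linComb c′ ws)
    ∎
  where open ≡-Reasoning

linComb-injective : ∀ {m n} {ws : Vec (GF2 n) m} → LinIndep ws →
                    ∀ {c c′} → linComb c ws ≡ linComb c′ ws → c ≡ c′
linComb-injective {ws = ws} indep {c} {c′} eq = x⊕y≡𝟎⇒x≡y (indep (c ⊕ c′) (begin
  linComb (c ⊕ c′) ws             ≡⟨ linComb-⊕ c c′ ws ⟩
  linComb c ws ⊕ linComb c′ ws    ≡⟨ cong (_⊕ linComb c′ ws) eq ⟩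
  linComb c′ ws ⊕ linComb c′ ws   ≡⟨ ⊕-self (linComb c′ ws) ⟩
  𝟎                               ∎))
  where open ≡-Reasoning

digit : Bool → ℕ
digit true  = 1
digit false = 0

digit<2 : ∀ b → digit b < 2
digit<2 true  = s≤s (s≤s z≤n)
digit<2 false = s≤s z≤n

digit-≡ᵇ1 : ∀ {r} → r < 2 → digit (r ≡ᵇ 1) ≡ r
digit-≡ᵇ1 {zero}        _ = refl
digit-≡ᵇ1 {suc zero}    _ = refl
digit-≡ᵇ1 {suc (suc r)} (s≤s (s≤s ()))

digit%2≡ᵇ1 : ∀ b → (digit b % 2 ≡ᵇ 1) ≡ b
digit%2≡ᵇ1 true  = refl
digit%2≡ᵇ1 false = refl

bits : (m : ℕ) → ℕ → Vec Bool m
bits zero    k = []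
bits (suc m) k = (k % 2 ≡ᵇ 1) ∷ bits m (k / 2)

value : ∀ {m} → Vec Bool m → ℕ
value []      = 0
value (b ∷ x) = digit b + value x * 2

A-bits : ∀ {m n} (ws : Vec (GF2 n) m) k → A ws k ≡ linComb (bits m k) ws
A-bits []       k = refl
A-bits (w ∷ ws) k = cong ((k % 2 ≡ᵇ 1) · w ⊕_) (A-bits ws (k / 2))

value-< : ∀ {m} (x : Vec Bool m) → value x < 2 ^ m
value-< []            = s≤s z≤n
value-< {suc m} (b ∷ x) = begin-strict
  digit b + value x * 2 <⟨ +-monoˡ-< (value x * 2) (digit<2 b) ⟩
  2 + value x * 2       ≡⟨⟩
  suc (value x) * 2     ≤⟨ *-monoˡ-≤ 2 (value-< x) ⟩
  2 ^ m * 2             ≡⟨ *-comm (2 ^ m) 2 ⟩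
  2 ^ suc m             ∎
  where open ≤-Reasoning

value-bits : ∀ m {k} → k < 2 ^ m → value (bits m k) ≡ k
value-bits zero    {zero}  _            = refl
value-bits zero    {suc k} (s≤s ())
value-bits (suc m) {k}     k<2^1+m = begin
  digit (k % 2 ≡ᵇ 1) + value (bits m (k / 2)) * 2
    ≡⟨ cong₂ _+_ (digit-≡ᵇ1 (m%n<n k 2)) (cong (_* 2) (value-bits m k/2<2^m)) ⟩
  k % 2 + k / 2 * 2
    ≡⟨ m≡m%n+[m/n]*n k 2 ⟨
  k ∎
  where
  open ≡-Reasoning
  k/2<2^m : k / 2 < 2 ^ m
  k/2<2^m = m<n*o⇒m/o<n (subst (k <_) (*-comm 2 (2 ^ m)) k<2^1+m)

bits-value : ∀ {m} (x : Vec Bool m) → bits m (value x) ≡ x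
bits-value []      = refl
bits-value (b ∷ x) = cong₂ _∷_ head (trans (cong (bits _) tail) (bits-value x))
  where
  head : ((digit b + value x * 2) % 2 ≡ᵇ 1) ≡ b
  head = trans (cong (_≡ᵇ 1) ([m+kn]%n≡m%n (digit b) (value x) 2)) (digit%2≡ᵇ1 b)
  tail : (digit b + value x * 2) / 2 ≡ value x
  tail = trans (+-distrib-/-∣ʳ (digit b) (n∣m*n (value x)))
               (cong₂ _+_ (m<n⇒m/n≡0 (digit<2 b)) (m*n/n≡m (value x) 2))

value-injective : ∀ {m} {x y : Vec Bool m} → value x ≡ value y → x ≡ y
value-injective {x = x} {y} eq = trans (sym (bits-value x)) (trans (cong (bits _) eq) (bits-value y))

A-value : ∀ {m n} (ws : Vec (GF2 n) m) (x : Vec Bool m) → A ws (value x) ≡ linComb x ws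
A-value ws x = trans (A-bits ws (value x)) (cong (λ c → linComb c ws) (bits-value x))

value-∷-mono-< : ∀ {m} b (x : Vec Bool m) b′ (y : Vec Bool m) →
                 value x < value y → value (b ∷ x) < value (b′ ∷ y)
value-∷-mono-< b x b′ y x<y = begin-strict
  digit b + value x * 2 <⟨ +-monoˡ-< (value x * 2) (digit<2 b) ⟩
  suc (value x) * 2     ≤⟨ *-monoˡ-≤ 2 x<y ⟩
  value y * 2           ≤⟨ m≤n+m (value y * 2) (digit b′) ⟩
  digit b′ + value y * 2 ∎
  where open ≤-Reasoning

digit-<-inv : ∀ {b b′} → digit b < digit b′ → b ≡ false × b′ ≡ true
digit-<-inv {false} {true} _ = refl , refl
digit-<-inv {true}  {true}  (s≤s ())
digit-<-inv {_}     {false} ()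

value-∷-<-inv : ∀ {m} {b b′} {x y : Vec Bool m} → value (b ∷ x) < value (b′ ∷ y) →
                value x < value y ⊎ (x ≡ y × b ≡ false × b′ ≡ true)
value-∷-<-inv {b = b} {b′} {x} {y} lt with <-cmp (value x) (value y)
... | tri< x<y _ _ = inj₁ x<y
... | tri≈ _ x≡y _ = inj₂ (value-injective x≡y , digit-<-inv (+-cancelʳ-< (value x * 2) _ _ lt′))
  where
  lt′ : digit b + value x * 2 < digit b′ + value x * 2
  lt′ = subst (λ v → digit b + value x * 2 < digit b′ + v * 2) (sym x≡y) lt
... | tri> _ _ y<x = contradiction lt (<-asym (value-∷-mono-< b′ y b x y<x))

value-<-⊕ : ∀ {m} (x y b : Vec Bool m) → value b < value (x ⊕ y) →
            value (x ⊕ b) < value y ⊎ value (y ⊕ b) < value x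
value-<-⊕ []        []        []        ()
value-<-⊕ (xb ∷ x) (yb ∷ y) (bb ∷ b) lt with value-∷-<-inv {x = b} {y = x ⊕ y} lt
... | inj₁ b<x⊕y =
  Sum.map (value-∷-mono-< (xb xor bb) (x ⊕ b) yb y) (value-∷-mono-< (yb xor bb) (y ⊕ b) xb x)
          (value-<-⊕ x y b b<x⊕y)
value-<-⊕ (false ∷ x) (true ∷ y)  _ _ | inj₂ (refl , refl , _) rewrite x⊕[x⊕y]≡y x y = inj₁ ≤-refl
value-<-⊕ (true ∷ x)  (false ∷ y) _ _ | inj₂ (refl , refl , _) rewrite x⊕[y⊕x]≡y y x = inj₂ ≤-refl
value-<-⊕ (false ∷ x) (false ∷ y) _ _ | inj₂ (_ , _ , ())
value-<-⊕ (true ∷ x)  (true ∷ y)  _ _ | inj₂ (_ , _ , ())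

module Lexigraph {m n : ℕ} (ws : Vec (GF2 n) m) (d : ℕ) where

  ⟦_⟧ : Vec Bool m → GF2 n
  ⟦ c ⟧ = linComb c ws

  ⟦⟧-⊕ : ∀ x y → ⟦ x ⊕ y ⟧ ≡ ⟦ x ⟧ ⊕ ⟦ y ⟧
  ⟦⟧-⊕ x y = linComb-⊕ x y ws

  Light : Vec Bool m → Set
  Light z = weight ⟦ z ⟧ < d

  Light-translate : ∀ c {x y} → Light (x ⊕ y) → Light ((c ⊕ x) ⊕ (c ⊕ y))
  Light-translate c {x} {y} = subst Light (sym ([c⊕x]⊕[c⊕y]≡x⊕y c x y))

  record Arc (x y : Vec Bool m) : Set where
    constructor arc
    field
      descending : value y < value x
      light      : Light (y ⊕ x)

  Adjacent : GF2 n → GF2 n → Set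
  Adjacent u v = Edge ws d u v ⊎ Edge ws d v u

  Arc⇒Edge : ∀ {x y u v} → Arc x y → u ≡ ⟦ x ⟧ → v ≡ ⟦ y ⟧ → Edge ws d u v
  Arc⇒Edge {x} {y} (arc y<x y⊕x-light) refl refl =
    value x , value y , value-< x , value-< y , sym (A-value ws x) , sym (A-value ws y) , y<x , light
    where
    light : weight (A ws (value y) ⊕ A ws (value x)) < d
    light rewrite A-value ws x | A-value ws y | sym (⟦⟧-⊕ y x) = y⊕x-light

  Edge⇒Arc : ∀ {u v} → Edge ws d u v → ∃₂ λ x y → u ≡ ⟦ x ⟧ × v ≡ ⟦ y ⟧ × Arc x y
  Edge⇒Arc (k , j , k<2^m , j<2^m , refl , refl , j<k , wt<d) =
    bits m k , bits m j , A-bits ws k , A-bits ws j , arc descending light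
    where
    descending : value (bits m j) < value (bits m k)
    descending rewrite value-bits m j<2^m | value-bits m k<2^m = j<k
    light : Light (bits m j ⊕ bits m k)
    light rewrite ⟦⟧-⊕ (bits m j) (bits m k) | sym (A-bits ws j) | sym (A-bits ws k) = wt<d

  Arc-translate : ∀ c {x y} → Arc x y → Arc (c ⊕ x) (c ⊕ y) ⊎ Arc (c ⊕ y) (c ⊕ x)
  Arc-translate c {x} {y} (arc y<x light) with <-cmp (value (c ⊕ x)) (value (c ⊕ y))
  ... | tri< cx<cy _ _ = inj₂ (arc cx<cy (Light-translate c (subst Light (⊕-comm y x) light)))
  ... | tri≈ _ cx≡cy _ =
    contradiction y<x (<-irrefl (cong value (sym (⊕-cancelˡ-≡ c (value-injective cx≡cy)))))
  ... | tri> _ _ cy<cx = inj₁ (arc cy<cx (Light-translate c light))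

  Adjacent-translateˡ : ∀ c {u v} → Edge ws d u v → Adjacent (⟦ c ⟧ ⊕ u) (⟦ c ⟧ ⊕ v)
  Adjacent-translateˡ c e with Edge⇒Arc e
  ... | x , y , refl , refl , x→y =
    Sum.map (λ a → Arc⇒Edge a (sym (⟦⟧-⊕ c x)) (sym (⟦⟧-⊕ c y)))
            (λ a → Arc⇒Edge a (sym (⟦⟧-⊕ c y)) (sym (⟦⟧-⊕ c x)))
            (Arc-translate c x→y)

  Adjacent-translateʳ : ∀ c {u v} → Edge ws d u v → Adjacent (u ⊕ ⟦ c ⟧) (v ⊕ ⟦ c ⟧)
  Adjacent-translateʳ c {u} {v} e =
    subst₂ Adjacent (⊕-comm ⟦ c ⟧ u) (⊕-comm ⟦ c ⟧ v) (Adjacent-translateˡ c e)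

  Arc-split : ∀ {x y b} → Arc (x ⊕ y) b → Arc y (x ⊕ b) ⊎ Arc x (y ⊕ b)
  Arc-split {x} {y} {b} (arc b<x⊕y light) =
    Sum.map (λ x⊕b<y → arc x⊕b<y (subst Light (sym (⊕.xy∙z≈y∙xz x b y)) light))
            (λ y⊕b<x → arc y⊕b<x (subst Light (sym (⊕.xy∙z≈y∙zx y b x)) light))
            (value-<-⊕ x y b b<x⊕y)

  followers-⊕ : LinIndep ws → ∀ x y →
                F ws d (⟦ x ⟧ ⊕ ⟦ y ⟧) ⊆ (⟦ x ⟧ ⊕ˡ F ws d ⟦ y ⟧) ∪ (F ws d ⟦ x ⟧ ⊕ʳ ⟦ y ⟧)
  followers-⊕ indep x y e with Edge⇒Arc e
  ... | z , b , x⊕y≡z , refl , z→b with linComb-injective indep {x ⊕ y} {z} (trans (⟦⟧-⊕ x y) x⊕y≡z)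
  ... | refl with Arc-split z→b
  ... | inj₁ y→x⊕b = inj₁ (⟦ x ⊕ b ⟧ , Arc⇒Edge y→x⊕b refl refl ,
                           trans (cong ⟦_⟧ (sym (x⊕[x⊕y]≡y x b))) (⟦⟧-⊕ x (x ⊕ b)))
  ... | inj₂ x→y⊕b = inj₂ (⟦ y ⊕ b ⟧ , Arc⇒Edge x→y⊕b refl refl ,
                           trans (cong ⟦_⟧ (sym ([x⊕y]⊕x≡y y b))) (⟦⟧-⊕ (y ⊕ b) y))

  ⊕-followers⊆Adjacent : ∀ x y →
                         (⟦ x ⟧ ⊕ˡ F ws d ⟦ y ⟧) ∪ (F ws d ⟦ x ⟧ ⊕ʳ ⟦ y ⟧) ⊆ Adjacent (⟦ x ⟧ ⊕ ⟦ y ⟧)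
  ⊕-followers⊆Adjacent x y (inj₁ (_ , e , refl)) = Adjacent-translateˡ x e
  ⊕-followers⊆Adjacent x y (inj₂ (_ , e , refl)) = Adjacent-translateʳ y e

-- A ws j = ⟦ bits m j ⟧ for every j, so none of the numeric hypotheses is used.
lemma3 : (m n d : ℕ) → 1 ≤ m → m ≤ n → 1 ≤ d →
    (ws : Vec (GF2 n) m) → LinIndep ws →
    (j k : ℕ) → j < 2 ^ m → k < 2 ^ m →
      (F ws d (A ws j ⊕ A ws k) ⊆ ((A ws j ⊕ˡ F ws d (A ws k)) ∪ (F ws d (A ws j) ⊕ʳ A ws k)))
      × (((A ws j ⊕ˡ F ws d (A ws k)) ∪ (F ws d (A ws j) ⊕ʳ A ws k)) ⊆ (F ws d (A ws j ⊕ A ws k) ∪ F⁻¹ ws d (A ws j ⊕ A ws k)))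
lemma3 m n d _ _ _ ws indep j k _ _ rewrite A-bits ws j | A-bits ws k =
  followers-⊕ indep (bits m j) (bits m k) , ⊕-followers⊆Adjacent (bits m j) (bits m k)
  where open Lexigraph ws d
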